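{- Let $\mathbf U=\langle\langle U,\approx\rangle,\preceq\rangle$ be a completely lattice $\mathbf L$-ordered set and $\sim_1,\sim_2$ complete $\mathbf L$-tolerances on $\mathbf U$. Then $$S(\sim_1,\sim_2)=\bigwedge_{u\in U}(u_{\sim_2}\preceq u_{\sim_1})\wedge\bigwedge_{u\in U}(u^{\sim_1}\preceq u^{\sim_2}),$$ where $S(\sim_1,\sim_2)=\bigwedge_{u,v\in U}\big((u\sim_1 v)\to(u\sim_2 v)\big)$; i.e. $S(\sim_1,\sim_2)=\langle{}_{\sim_1},{}^{\sim_1}\rangle\preceq_{\mathrm{IGal}}\langle{}_{\sim_2},{}^{\sim_2}\rangle$.
   Context: $\mathbf L=\langle L,\wedge,\vee,\otimes,\to,0,1\rangle$ is a complete residuated lattice ($\langle L,\wedge,\vee,0,1\rangle$ complete lattice, $\langle L,\otimes,1\rangle$ commutative monoid, $a\otimes b\le c$ iff $a\le b\to c$). An $\mathbf L$-set in $X$ is a map $X\to L$; $L^X$ the set of them; $S(A,B)=\bigwedge_x(A(x)\to B(x))$. An $\mathbf L$-equality is a binary $\mathbf L$-relation that is reflexive, symmetric, transitive ($R(x,y)\otimes R(y,z)\le R(x,z)$) and with $R(x,y)=1\Rightarrow x=y$. An $\mathbf L$-ordered set is $\langle\langle U,\approx\rangle,\preceq\rangle$, $\approx$ an $\mathbf L$-equality, $\preceq$ reflexive, transitive, compatible with $\approx$ ($(u\preceq v)\otimes(u\approx u')\otimes(v\approx v')\le(u'\preceq v')$), and $(u\preceq v)\wedge(v\preceq u)\le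 u\approx v$. For $V\in L^U$: $\mathcal L V(v)=\bigwedge_u(V(u)\to(v\preceq u))$, $\mathcal U V(v)=\bigwedge_u(V(u)\to(u\preceq v))$; $\inf V$ is the unique $u$ with $\mathcal L V(u)=1=\mathcal U(\mathcal L V)(u)$, $\sup V$ the unique $u$ with $\mathcal U V(u)=1=\mathcal L(\mathcal U V)(u)$; completely lattice means these exist for all $V$. Power relation: for $R$ on $X$, $A,B\in L^X$, $(R\circ B)(x)=\bigvee_y R(x,y)\otimes B(y)$, $(A\circ R)(y)=\bigvee_x A(x)\otimes R(x,y)$, $R^+(A,B)=S(A,R\circ B)\wedge S(B,A\circ R)$. A binary $\mathbf L$-relation $R$ on $\mathbf U$ is complete if it is compatible with $\approx$ ($R(u,v)\otimes(u\approx u')\otimes(v\approx v')\le R(u',v')$) and $R^+(V_1,V_2)\le R(\inf V_1,\inf V_2)$, $R^+(V_1,V_2)\le R(\sup V_1,\sup V_2)$ for all $V_1,V_2\in L^U$. An $\mathbf L$-tolerance is a reflexive symmetric binary $\mathbf L$-relation. For $u\in U$, $[u]_\sim(v)=u\sim v$, $u_\sim=\inf[u]_\sim$, $u^\sim=\sup[u]_\sim$. For pairs of maps $\langle f_i,g_i\rangle$ on $U$, $\langle f_1,g_1\rangle\preceq_{\mathrm{IGal}}\langle f_2,g_2\rangle=\bigwedge_u(f_2(u)\preceq f_1(u))\wedge\bigwedge_v(g_1(v)\preceq g_2(v))$. -}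

module Defs where

open import Data.Product using (Σ; _×_; _,_; proj₁; proj₂)
open import Relation.Binary.PropositionalEquality using (_≡_)

record CompleteResiduatedLattice : Set₁ where
  infixr 7 _⊗_
  infixr 5 _⇒_
  infixr 6 _∧_
  infixr 6 _∨_
  infix 4 _≤_
  field
    Carrier : Set
    _≤_ : Carrier → Carrier → Set
    ≤-refl : ∀ {a} → a ≤ a
    ≤-trans : ∀ {a b c} → a ≤ b → b ≤ c → a ≤ c
    ≤-antisym : ∀ {a b} → a ≤ b → b ≤ a → a ≡ b
    _∧_ : Carrier → Carrier → Carrier
    ∧-lb₁ : ∀ a b → (a ∧ b) ≤ a
    ∧-lb₂ : ∀ a b → (a ∧ b) ≤ b
    ∧-glb : ∀ {a b c} → c ≤ a → c ≤ b → c ≤ (a ∧ b)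
    _∨_ : Carrier → Carrier → Carrier
    ∨-ub₁ : ∀ a b → a ≤ (a ∨ b)
    ∨-ub₂ : ∀ a b → b ≤ (a ∨ b)
    ∨-lub : ∀ {a b c} → a ≤ c → b ≤ c → (a ∨ b) ≤ c
    ⋀ : {I : Set} → (I → Carrier) → Carrier
    ⋀-lb : ∀ {I} (f : I → Carrier) (i : I) → ⋀ f ≤ f i
    ⋀-glb : ∀ {I} (f : I → Carrier) {c} → (∀ i → c ≤ f i) → c ≤ ⋀ f
    ⋁ : {I : Set} → (I → Carrier) → Carrier
    ⋁-ub : ∀ {I} (f : I → Carrier) (i : I) → f i ≤ ⋁ f
    ⋁-lub : ∀ {I} (f : I → Carrier) {c} → (∀ i → f i ≤ c) → ⋁ f ≤ c
    𝟘 𝟙 : Carrier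
    𝟘-least : ∀ a → 𝟘 ≤ a
    𝟙-greatest : ∀ a → a ≤ 𝟙
    _⊗_ : Carrier → Carrier → Carrier
    ⊗-assoc : ∀ a b c → (a ⊗ b) ⊗ c ≡ a ⊗ (b ⊗ c)
    ⊗-comm : ∀ a b → a ⊗ b ≡ b ⊗ a
    ⊗-identityˡ : ∀ a → 𝟙 ⊗ a ≡ a
    _⇒_ : Carrier → Carrier → Carrier
    residuation₁ : ∀ {a b c} → (a ⊗ b) ≤ c → a ≤ (b ⇒ c)
    residuation₂ : ∀ {a b c} → a ≤ (b ⇒ c) → (a ⊗ b) ≤ c

module Theory (𝐋 : CompleteResiduatedLattice) where
  open CompleteResiduatedLattice 𝐋 public

  L = Carrier

  LSet : Set → Set
  LSet X = X → L

  S : {X : Set} → LSet X → LSet X → L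
  S A B = ⋀ (λ x → A x ⇒ B x)

  LRel : Set → Set
  LRel X = X → X → L

  S₂ : {X : Set} → LRel X → LRel X → L
  S₂ {X} R₁ R₂ = ⋀ {X × X} (λ p → R₁ (proj₁ p) (proj₂ p) ⇒ R₂ (proj₁ p) (proj₂ p))

  record IsLEquality {X : Set} (E : LRel X) : Set where
    field
      refl : ∀ x → E x x ≡ 𝟙
      sym : ∀ x y → E x y ≡ E y x
      trans : ∀ x y z → (E x y ⊗ E y z) ≤ E x z
      sep : ∀ x y → E x y ≡ 𝟙 → x ≡ y

  record LOrderedSet : Set₁ where
    field
      U : Set
      _≈_ : LRel U
      _≼_ : LRel U
      ≈-isLEquality : IsLEquality _≈_
      ≼-refl : ∀ u → (u ≼ u) ≡ 𝟙
      ≼-trans : ∀ u v w → ((u ≼ v) ⊗ (v ≼ w)) ≤ (u ≼ w)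
      ≼-compat : ∀ u v u′ v′ → ((u ≼ v) ⊗ (u ≈ u′) ⊗ (v ≈ v′)) ≤ (u′ ≼ v′)
      ≼-antisym : ∀ u v → ((u ≼ v) ∧ (v ≼ u)) ≤ (u ≈ v)

  module OrderTheory (𝐔 : LOrderedSet) where
    open LOrderedSet 𝐔 public

    lowerCone : LSet U → LSet U
    lowerCone V v = ⋀ (λ u → V u ⇒ (v ≼ u))

    upperCone : LSet U → LSet U
    upperCone V v = ⋀ (λ u → V u ⇒ (u ≼ v))

    IsInf : LSet U → U → Set
    IsInf V u = (lowerCone V u ≡ 𝟙) × (upperCone (lowerCone V) u ≡ 𝟙)

    IsSup : LSet U → U → Set
    IsSup V u = (upperCone V u ≡ 𝟙) × (lowerCone (upperCone V) u ≡ 𝟙)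

    -- completely lattice: infima and suprema exist for every L-set V
    -- (they are automatically unique)
    record CompletelyLattice : Set where
      field
        infExists : ∀ (V : LSet U) → Σ U (IsInf V)
        supExists : ∀ (V : LSet U) → Σ U (IsSup V)

      inf : LSet U → U
      inf V = proj₁ (infExists V)

      sup : LSet U → U
      sup V = proj₁ (supExists V)

    module _ where
      _∘ʳ_ : LRel U → LSet U → LSet U
      (R ∘ʳ B) x = ⋁ (λ y → R x y ⊗ B y)

      _∘ˡ_ : LSet U → LRel U → LSet U
      (A ∘ˡ R) y = ⋁ (λ x → A x ⊗ R x y)

      _⁺ : LRel U → LSet U → LSet U → L
      (R ⁺) A B = S A (R ∘ʳ B) ∧ S B (A ∘ˡ R)

    IsCompatible : LRel U → Set
    IsCompatible R = ∀ u v u′ v′ → (R u v ⊗ (u ≈ u′) ⊗ (v ≈ v′)) ≤ R u′ v′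

    IsComplete : CompletelyLattice → LRel U → Set
    IsComplete CL R =
      IsCompatible R
      × (∀ V₁ V₂ → (R ⁺) V₁ V₂ ≤ R (inf V₁) (inf V₂))
      × (∀ V₁ V₂ → (R ⁺) V₁ V₂ ≤ R (sup V₁) (sup V₂))
      where open CompletelyLattice CL

    IsTolerance : LRel U → Set
    IsTolerance R = (∀ u → R u u ≡ 𝟙) × (∀ u v → R u v ≡ R v u)

    class : LRel U → U → LSet U
    class R u v = R u v

    lowerOf : CompletelyLattice → LRel U → U → U
    lowerOf CL R u = CompletelyLattice.inf CL (class R u)

    upperOf : CompletelyLattice → LRel U → U → U
    upperOf CL R u = CompletelyLattice.sup CL (class R u)

-- A complete tolerance ∼ is an interval relation: u ∼ v is the degree to which
-- v lies between u_∼ and u^∼, i.e. (u_∼ ≼ v) ∧ (v ≼ u^∼).  The inequality ≥ is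
-- obtained by applying completeness of ∼ to two-point L-sets: first
-- sup {u, v} ∼ v to degree (u_∼ ≼ v), using u ∼ u_∼ and the L-set {(u_∼ ≼ v)/u_∼, v}
-- whose supremum is v; then u = inf {sup {u, v}, u} ∼ inf {v, (v ≼ u^∼)/u^∼} = v.
-- Given this description of ∼₁ and ∼₂, the theorem says that shrinking the
-- intervals is the same as shrinking the relation: ≥ by transitivity of ≼,
-- ≤ because inf is antitone and sup monotone in the subsethood degree.
module Submission where

open import Defs
open import Data.Product using (_,_; proj₁; proj₂)
open import Relation.Binary.PropositionalEquality using (_≡_; refl; sym; trans; subst; subst₂)

module ResiduatedLatticeProperties (𝐋 : CompleteResiduatedLattice) where
  open Theory 𝐋

  infixr 4 _▸_
  _▸_ : ∀ {a b c} → a ≤ b → b ≤ c → a ≤ c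
  _▸_ = ≤-trans

  ≡⇒≤ : ∀ {a b} → a ≡ b → a ≤ b
  ≡⇒≤ refl = ≤-refl

  𝟙≤⇒≡𝟙 : ∀ {a} → 𝟙 ≤ a → a ≡ 𝟙
  𝟙≤⇒≡𝟙 {a} = ≤-antisym (𝟙-greatest a)

  ≡𝟙⇒𝟙≤ : ∀ {a} → a ≡ 𝟙 → 𝟙 ≤ a
  ≡𝟙⇒𝟙≤ refl = ≤-refl

  ⊗-identityʳ : ∀ a → a ⊗ 𝟙 ≡ a
  ⊗-identityʳ a = trans (⊗-comm a 𝟙) (⊗-identityˡ a)

  ⊗-monoˡ : ∀ {a b} c → a ≤ b → a ⊗ c ≤ b ⊗ c
  ⊗-monoˡ c a≤b = residuation₂ (a≤b ▸ residuation₁ ≤-refl)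

  ⊗-monoʳ : ∀ {a b} c → a ≤ b → c ⊗ a ≤ c ⊗ b
  ⊗-monoʳ {a} {b} c a≤b = ≡⇒≤ (⊗-comm c a) ▸ ⊗-monoˡ c a≤b ▸ ≡⇒≤ (⊗-comm b c)

  ⊗-mono : ∀ {a b c d} → a ≤ b → c ≤ d → a ⊗ c ≤ b ⊗ d
  ⊗-mono {b = b} {c} a≤b c≤d = ⊗-monoˡ c a≤b ▸ ⊗-monoʳ b c≤d

  ≤-⊗ˡ : ∀ {a c} → 𝟙 ≤ c → a ≤ c ⊗ a
  ≤-⊗ˡ {a} 𝟙≤c = ≡⇒≤ (sym (⊗-identityˡ a)) ▸ ⊗-monoˡ a 𝟙≤c

  ≤-⊗ʳ : ∀ {a c} → 𝟙 ≤ c → a ≤ a ⊗ c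
  ≤-⊗ʳ {a} 𝟙≤c = ≡⇒≤ (sym (⊗-identityʳ a)) ▸ ⊗-monoʳ a 𝟙≤c

  ≤-⊗-𝟙 : ∀ {a b c} → 𝟙 ≤ b → 𝟙 ≤ c → a ≤ b ⊗ c
  ≤-⊗-𝟙 {a} 𝟙≤b 𝟙≤c = 𝟙-greatest a ▸ ≤-⊗ˡ 𝟙≤b ▸ ⊗-monoʳ _ 𝟙≤c

  ⇒-intro : ∀ {a b} → a ≤ b → 𝟙 ≤ (a ⇒ b)
  ⇒-intro {a} a≤b = residuation₁ (≡⇒≤ (⊗-identityˡ a) ▸ a≤b)

  ⇒-elim : ∀ {a b} → 𝟙 ≤ (a ⇒ b) → a ≤ b
  ⇒-elim {a} 𝟙≤a⇒b = ≡⇒≤ (sym (⊗-identityˡ a)) ▸ residuation₂ 𝟙≤a⇒b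

  ⊗-∨-lub : ∀ {a b c d} → a ⊗ b ≤ d → a ⊗ c ≤ d → a ⊗ (b ∨ c) ≤ d
  ⊗-∨-lub {a} {b} {c} ab≤d ac≤d =
    ≡⇒≤ (⊗-comm a (b ∨ c)) ▸
    residuation₂ (∨-lub (residuation₁ (≡⇒≤ (⊗-comm b a) ▸ ab≤d))
                        (residuation₁ (≡⇒≤ (⊗-comm c a) ▸ ac≤d)))

  ⊗-shift : ∀ {c a e a′ r r′} → c ⊗ a ≤ a′ ⊗ r → r ⊗ e ≤ r′ → c ⊗ (a ⊗ e) ≤ a′ ⊗ r′
  ⊗-shift {c} {a} {e} {a′} {r} ca≤a′r re≤r′ =
    ≡⇒≤ (sym (⊗-assoc c a e)) ▸ ⊗-monoˡ e ca≤a′r ▸ ≡⇒≤ (⊗-assoc a′ r e) ▸ ⊗-monoʳ a′ re≤r′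

module OrderedSetProperties (𝐋 : CompleteResiduatedLattice) (𝐔 : Theory.LOrderedSet 𝐋) where
  open Theory 𝐋
  open OrderTheory 𝐔
  open ResiduatedLatticeProperties 𝐋
  open IsLEquality ≈-isLEquality using (sep) renaming (refl to ≈-refl)

  𝟙≤≈-refl : ∀ u → 𝟙 ≤ (u ≈ u)
  𝟙≤≈-refl u = ≡𝟙⇒𝟙≤ (≈-refl u)

  𝟙≤≼-refl : ∀ u → 𝟙 ≤ (u ≼ u)
  𝟙≤≼-refl u = ≡𝟙⇒𝟙≤ (≼-refl u)

  ≼-antisym-𝟙 : ∀ {u v} → 𝟙 ≤ (u ≼ v) → 𝟙 ≤ (v ≼ u) → u ≡ v
  ≼-antisym-𝟙 {u} {v} u≼v v≼u = sep u v (𝟙≤⇒≡𝟙 (∧-glb u≼v v≼u ▸ ≼-antisym u v))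

  compatibleʳ : ∀ {R} → IsCompatible R → ∀ u v v′ → R u v ⊗ (v ≈ v′) ≤ R u v′
  compatibleʳ {R} compat u v v′ = ⊗-monoʳ (R u v) (≤-⊗ˡ (𝟙≤≈-refl u)) ▸ compat u v u v′

  compatibleˡ : ∀ {R} → IsCompatible R → ∀ u v u′ → R u v ⊗ (u ≈ u′) ≤ R u′ v
  compatibleˡ {R} compat u v u′ = ⊗-monoʳ (R u v) (≤-⊗ʳ (𝟙≤≈-refl v)) ▸ compat u v u′ v

  ≼-respʳ-≈ : ∀ {a w u} v → a ≤ (w ≼ u) → a ⊗ (u ≈ v) ≤ (w ≼ v)
  ≼-respʳ-≈ {w = w} {u} v a≤w≼u = ⊗-monoˡ (u ≈ v) a≤w≼u ▸ compatibleʳ ≼-compat w u v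

  ≼-respˡ-≈ : ∀ {a w u} v → a ≤ (u ≼ w) → a ⊗ (u ≈ v) ≤ (v ≼ w)
  ≼-respˡ-≈ {w = w} {u} v a≤u≼w = ⊗-monoˡ (u ≈ v) a≤u≼w ▸ compatibleˡ ≼-compat u w v

  lowerCone≡𝟙⇒ : ∀ {V w} → lowerCone V w ≡ 𝟙 → ∀ u → V u ≤ (w ≼ u)
  lowerCone≡𝟙⇒ cone≡𝟙 u = ⇒-elim (≡𝟙⇒𝟙≤ cone≡𝟙 ▸ ⋀-lb _ u)

  upperCone≡𝟙⇒ : ∀ {V w} → upperCone V w ≡ 𝟙 → ∀ u → V u ≤ (u ≼ w)
  upperCone≡𝟙⇒ cone≡𝟙 u = ⇒-elim (≡𝟙⇒𝟙≤ cone≡𝟙 ▸ ⋀-lb _ u)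

  interval-⊗-≼ : ∀ l₁ l₂ h₁ h₂ v →
    ((l₂ ≼ l₁) ∧ (h₁ ≼ h₂)) ⊗ ((l₁ ≼ v) ∧ (v ≼ h₁)) ≤ (l₂ ≼ v) ∧ (v ≼ h₂)
  interval-⊗-≼ l₁ l₂ h₁ h₂ v = ∧-glb
    (⊗-mono (∧-lb₁ _ _) (∧-lb₁ _ _) ▸ ≼-trans l₂ l₁ v)
    (≡⇒≤ (⊗-comm _ _) ▸ ⊗-mono (∧-lb₂ _ _) (∧-lb₂ _ _) ▸ ≼-trans v h₁ h₂)

  singleton : U → LSet U
  singleton u = u ≈_

  pair : L → U → L → U → LSet U
  pair a x b y z = (a ⊗ (x ≈ z)) ∨ (b ⊗ (y ≈ z))

  pair-atˡ : ∀ a x b y → a ≤ pair a x b y x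
  pair-atˡ a x b y = ≤-⊗ʳ (𝟙≤≈-refl x) ▸ ∨-ub₁ _ _

  pair-atʳ : ∀ a x b y → b ≤ pair a x b y y
  pair-atʳ a x b y = ≤-⊗ʳ (𝟙≤≈-refl y) ▸ ∨-ub₂ _ _

  pair-power : ∀ {R} → IsCompatible R → ∀ {c a₁ x₁ b₁ y₁ a₂ x₂ b₂ y₂} →
    c ⊗ a₁ ≤ a₂ ⊗ R x₁ x₂ → c ⊗ b₁ ≤ b₂ ⊗ R y₁ y₂ →
    c ⊗ a₂ ≤ a₁ ⊗ R x₁ x₂ → c ⊗ b₂ ≤ b₁ ⊗ R y₁ y₂ →
    c ≤ (R ⁺) (pair a₁ x₁ b₁ y₁) (pair a₂ x₂ b₂ y₂)
  pair-power {R} compat {a₁ = a₁} {x₁} {b₁} {y₁} {a₂} {x₂} {b₂} {y₂} ha₁ hb₁ ha₂ hb₂ =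
    ∧-glb (⋀-glb _ λ z → residuation₁ (⊗-∨-lub
            (⊗-shift ha₁ (compatibleˡ compat x₁ x₂ z) ▸ toR∘V₂ z (pair-atˡ a₂ x₂ b₂ y₂))
            (⊗-shift hb₁ (compatibleˡ compat y₁ y₂ z) ▸ toR∘V₂ z (pair-atʳ a₂ x₂ b₂ y₂))))
          (⋀-glb _ λ z → residuation₁ (⊗-∨-lub
            (⊗-shift ha₂ (compatibleʳ compat x₁ x₂ z) ▸ toV₁∘R z (pair-atˡ a₁ x₁ b₁ y₁))
            (⊗-shift hb₂ (compatibleʳ compat y₁ y₂ z) ▸ toV₁∘R z (pair-atʳ a₁ x₁ b₁ y₁))))
    where
      V₁ V₂ : LSet U
      V₁ = pair a₁ x₁ b₁ y₁
      V₂ = pair a₂ x₂ b₂ y₂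
      toR∘V₂ : ∀ z {a x} → a ≤ V₂ x → a ⊗ R z x ≤ (R ∘ʳ V₂) z
      toR∘V₂ z {a} {x} a≤V₂x =
        ≡⇒≤ (⊗-comm a (R z x)) ▸ ⊗-monoʳ (R z x) a≤V₂x ▸ ⋁-ub (λ w → R z w ⊗ V₂ w) x
      toV₁∘R : ∀ z {a x} → a ≤ V₁ x → a ⊗ R x z ≤ (V₁ ∘ˡ R) z
      toV₁∘R z {x = x} a≤V₁x = ⊗-monoˡ (R x z) a≤V₁x ▸ ⋁-ub (λ w → V₁ w ⊗ R w z) x

  module Bounds (CL : CompletelyLattice) where
    open CompletelyLattice CL

    inf-lowerBound : ∀ V u → V u ≤ (inf V ≼ u)
    inf-lowerBound V = lowerCone≡𝟙⇒ (proj₁ (proj₂ (infExists V)))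

    inf-greatest : ∀ V w → lowerCone V w ≤ (w ≼ inf V)
    inf-greatest V = upperCone≡𝟙⇒ (proj₂ (proj₂ (infExists V)))

    sup-upperBound : ∀ V u → V u ≤ (u ≼ sup V)
    sup-upperBound V = upperCone≡𝟙⇒ (proj₁ (proj₂ (supExists V)))

    sup-least : ∀ V w → upperCone V w ≤ (sup V ≼ w)
    sup-least V = lowerCone≡𝟙⇒ (proj₂ (proj₂ (supExists V)))

    inf≡least : ∀ V w → (∀ u → V u ≤ (w ≼ u)) → 𝟙 ≤ V w → inf V ≡ w
    inf≡least V w lower 𝟙≤Vw = ≼-antisym-𝟙
      (𝟙≤Vw ▸ inf-lowerBound V w)
      (⋀-glb _ (λ u → ⇒-intro (lower u)) ▸ inf-greatest V w)

    sup≡greatest : ∀ V w → (∀ u → V u ≤ (u ≼ w)) → 𝟙 ≤ V w → sup V ≡ w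
    sup≡greatest V w upper 𝟙≤Vw = ≼-antisym-𝟙
      (⋀-glb _ (λ u → ⇒-intro (upper u)) ▸ sup-least V w)
      (𝟙≤Vw ▸ sup-upperBound V w)

    inf-antitone : ∀ V₁ V₂ → S V₁ V₂ ≤ (inf V₂ ≼ inf V₁)
    inf-antitone V₁ V₂ =
      ⋀-glb _ (λ u → residuation₁
        (⊗-monoˡ (V₁ u) (⋀-lb _ u) ▸ residuation₂ ≤-refl ▸ inf-lowerBound V₂ u))
      ▸ inf-greatest V₁ (inf V₂)

    sup-monotone : ∀ V₁ V₂ → S V₁ V₂ ≤ (sup V₁ ≼ sup V₂)
    sup-monotone V₁ V₂ =
      ⋀-glb _ (λ u → residuation₁
        (⊗-monoˡ (V₁ u) (⋀-lb _ u) ▸ residuation₂ ≤-refl ▸ sup-upperBound V₂ u))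
      ▸ sup-least V₁ (sup V₂)

    inf-singleton : ∀ u → inf (singleton u) ≡ u
    inf-singleton u = inf≡least (singleton u) u (λ v → ≤-⊗ˡ (𝟙≤≼-refl u) ▸ ≼-respʳ-≈ v ≤-refl) (𝟙≤≈-refl u)

    sup-singleton : ∀ u → sup (singleton u) ≡ u
    sup-singleton u = sup≡greatest (singleton u) u (λ v → ≤-⊗ˡ (𝟙≤≼-refl u) ▸ ≼-respˡ-≈ v ≤-refl) (𝟙≤≈-refl u)

  module CompleteTolerance (CL : CompletelyLattice) (R : LRel U)
                           (tolerance : IsTolerance R) (complete : IsComplete CL R) where
    open CompletelyLattice CL
    open Bounds CL

    compat : IsCompatible R
    compat = proj₁ complete

    inf-complete : ∀ V₁ V₂ → (R ⁺) V₁ V₂ ≤ R (inf V₁) (inf V₂)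
    inf-complete = proj₁ (proj₂ complete)

    sup-complete : ∀ V₁ V₂ → (R ⁺) V₁ V₂ ≤ R (sup V₁) (sup V₂)
    sup-complete = proj₂ (proj₂ complete)

    𝟙≤R-refl : ∀ u → 𝟙 ≤ R u u
    𝟙≤R-refl u = ≡𝟙⇒𝟙≤ (proj₁ tolerance u)

    power-singleton-class : ∀ u → 𝟙 ≤ (R ⁺) (singleton u) (class R u)
    power-singleton-class u =
      ∧-glb (⋀-glb _ λ z → ⇒-intro
               (≤-⊗ˡ (𝟙≤R-refl u) ▸ compatibleˡ compat u u z ▸ ≤-⊗ʳ (𝟙≤R-refl u) ▸
                ⋁-ub (λ w → R z w ⊗ R u w) u))
            (⋀-glb _ λ z → ⇒-intro
               (≤-⊗ˡ (𝟙≤≈-refl u) ▸ ⋁-ub (λ w → (u ≈ w) ⊗ R w z) u))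

    R-lowerOf : ∀ u → 𝟙 ≤ R u (lowerOf CL R u)
    R-lowerOf u = subst (λ t → 𝟙 ≤ R t (lowerOf CL R u)) (inf-singleton u)
      (power-singleton-class u ▸ inf-complete (singleton u) (class R u))

    R-upperOf : ∀ u → 𝟙 ≤ R u (upperOf CL R u)
    R-upperOf u = subst (λ t → 𝟙 ≤ R t (upperOf CL R u)) (sup-singleton u)
      (power-singleton-class u ▸ sup-complete (singleton u) (class R u))

    sup-pair-R : ∀ u v → (lowerOf CL R u ≼ v) ≤ R (sup (pair 𝟙 u 𝟙 v)) v
    sup-pair-R u v = subst (λ t → β ≤ R (sup (pair 𝟙 u 𝟙 v)) t) supV≡v
      (pair-power compat (⊗-monoʳ β (R-lowerOf u)) (≤-⊗-𝟙 ≤-refl (𝟙≤R-refl v))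
                         (≤-⊗-𝟙 ≤-refl (R-lowerOf u)) (≤-⊗-𝟙 ≤-refl (𝟙≤R-refl v))
       ▸ sup-complete (pair 𝟙 u 𝟙 v) V)
      where
        l : U
        l = lowerOf CL R u
        β : L
        β = l ≼ v
        V : LSet U
        V = pair β l 𝟙 v
        supV≡v : sup V ≡ v
        supV≡v = sup≡greatest V v
          (λ z → ∨-lub (≼-respˡ-≈ z ≤-refl) (≼-respˡ-≈ z (𝟙≤≼-refl v)))
          (pair-atʳ β l 𝟙 v)

    interval≤R : ∀ u v → (lowerOf CL R u ≼ v) ∧ (v ≼ upperOf CL R u) ≤ R u v
    interval≤R u v = subst₂ (λ s t → c ≤ R s t) infV₁≡u infV₂≡v
      (pair-power compat c≤RMv (≡⇒≤ (⊗-identityʳ c) ▸ ∧-lb₂ β α ▸ ≤-⊗ʳ (R-upperOf u))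
                         c≤RMv (≤-⊗-𝟙 ≤-refl (R-upperOf u))
       ▸ inf-complete V₁ V₂)
      where
        h M : U
        h = upperOf CL R u
        M = sup (pair 𝟙 u 𝟙 v)
        β α c : L
        β = lowerOf CL R u ≼ v
        α = v ≼ h
        c = β ∧ α
        V₁ V₂ : LSet U
        V₁ = pair 𝟙 M 𝟙 u
        V₂ = pair 𝟙 v α h
        u≼M : 𝟙 ≤ (u ≼ M)
        u≼M = pair-atˡ 𝟙 u 𝟙 v ▸ sup-upperBound (pair 𝟙 u 𝟙 v) u
        infV₁≡u : inf V₁ ≡ u
        infV₁≡u = inf≡least V₁ u
          (λ z → ∨-lub (≼-respʳ-≈ z u≼M) (≼-respʳ-≈ z (𝟙≤≼-refl u)))
          (pair-atʳ 𝟙 M 𝟙 u)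
        infV₂≡v : inf V₂ ≡ v
        infV₂≡v = inf≡least V₂ v
          (λ z → ∨-lub (≼-respʳ-≈ z (𝟙≤≼-refl v)) (≼-respʳ-≈ z ≤-refl))
          (pair-atˡ 𝟙 v α h)
        c≤RMv : c ⊗ 𝟙 ≤ 𝟙 ⊗ R M v
        c≤RMv = ≡⇒≤ (⊗-identityʳ c) ▸ ∧-lb₁ β α ▸ sup-pair-R u v
                ▸ ≡⇒≤ (sym (⊗-identityˡ (R M v)))

    R≡interval : ∀ u v → R u v ≡ (lowerOf CL R u ≼ v) ∧ (v ≼ upperOf CL R u)
    R≡interval u v = ≤-antisym
      (∧-glb (inf-lowerBound (class R u) v) (sup-upperBound (class R u) v))
      (interval≤R u v)

lemma25 : (𝐋 : CompleteResiduatedLattice) →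
    let open Theory 𝐋 in
    (𝐔 : LOrderedSet) →
    let open OrderTheory 𝐔 in
    (CL : CompletelyLattice) →
    (∼₁ ∼₂ : LRel U) →
    IsTolerance ∼₁ → IsComplete CL ∼₁ →
    IsTolerance ∼₂ → IsComplete CL ∼₂ →
    S₂ ∼₁ ∼₂ ≡ (⋀ (λ u → lowerOf CL ∼₂ u ≼ lowerOf CL ∼₁ u) ∧ ⋀ (λ u → upperOf CL ∼₁ u ≼ upperOf CL ∼₂ u))
lemma25 𝐋 𝐔 CL ∼₁ ∼₂ tol₁ complete₁ tol₂ complete₂ = ≤-antisym
  (∧-glb (⋀-glb _ λ u → S₂≤S-class u ▸ inf-antitone (class ∼₁ u) (class ∼₂ u))
         (⋀-glb _ λ u → S₂≤S-class u ▸ sup-monotone (class ∼₁ u) (class ∼₂ u)))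
  (⋀-glb _ λ (u , v) → residuation₁ (narrower-intervals u v))
  where
    open Theory 𝐋
    open OrderTheory 𝐔
    open ResiduatedLatticeProperties 𝐋 using (_▸_; ⊗-monoˡ)
    open OrderedSetProperties 𝐋 𝐔
    open Bounds CL
    module T₁ = CompleteTolerance CL ∼₁ tol₁ complete₁
    module T₂ = CompleteTolerance CL ∼₂ tol₂ complete₂

    narrower : L
    narrower = ⋀ (λ u → lowerOf CL ∼₂ u ≼ lowerOf CL ∼₁ u) ∧ ⋀ (λ u → upperOf CL ∼₁ u ≼ upperOf CL ∼₂ u)

    S₂≤S-class : ∀ u → S₂ ∼₁ ∼₂ ≤ S (class ∼₁ u) (class ∼₂ u)
    S₂≤S-class u = ⋀-glb _ λ v → ⋀-lb _ (u , v)

    narrower-intervals : ∀ u v → narrower ⊗ ∼₁ u v ≤ ∼₂ u v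
    narrower-intervals u v = subst₂ (λ r₁ r₂ → narrower ⊗ r₁ ≤ r₂)
      (sym (T₁.R≡interval u v)) (sym (T₂.R≡interval u v))
      (⊗-monoˡ _ (∧-glb (∧-lb₁ _ _ ▸ ⋀-lb _ u) (∧-lb₂ _ _ ▸ ⋀-lb _ u))
       ▸ interval-⊗-≼ _ _ _ _ v)
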